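{- Let $r,n$ be positive integers and $c>0$ with $cn$ an integer, and suppose $n>(4cr)^{2^{r+3}}$. Let $G$ be a tripartite graph with parts $V_0,V_1,V_2$, where $|V_1|=|V_2|=n$, $|V_0|=cn$, and every vertex of $V_1$ is adjacent to every vertex of $V_2$. Suppose the edges of $G$ are colored with $r$ colors so that there is a collection of $n^2$ pairwise edge-disjoint monochromatic triangles covering all edges between $V_1$ and $V_2$. Then $G$ contains a monochromatic diamond, i.e., an edge that lies in two distinct monochromatic triangles.
   Context: A tripartite graph with parts $V_0,V_1,V_2$ has no edges inside any part. A triangle is monochromatic if all three of its edges receive the same color. -}

module Defs where

open import Data.Nat using (ℕ; _+_; _*_; _^_; _<_)
open import Data.Fin using (Fin)
open import Data.Product using (_×_; _,_; Σ; ∃)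
open import Data.Sum using (_⊎_)
open import Relation.Binary.PropositionalEquality using (_≡_; _≢_)
open import Relation.Nullary using (¬_)
open import Data.Empty using (⊥)

-- Vertices of a tripartite graph with parts V₀ (size m = cn), V₁, V₂ (size n).
data Vtx (m n : ℕ) : Set where
  v₀ : Fin m → Vtx m n
  v₁ : Fin n → Vtx m n
  v₂ : Fin n → Vtx m n

data Part : Set where
  P₀ P₁ P₂ : Part

part : ∀ {m n} → Vtx m n → Part
part (v₀ _) = P₀
part (v₁ _) = P₁
part (v₂ _) = P₂

record TripartiteGraph (m n : ℕ) : Set₁ where
  field
    Adj       : Vtx m n → Vtx m n → Set
    Adj-sym   : ∀ {u v} → Adj u v → Adj v u
    no-inside : ∀ {u v} → Adj u v → part u ≢ part v
open TripartiteGraph public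

-- An r-colouring of the edges, represented as a symmetric colouring of all
-- vertex pairs (only its values on edges of G are ever used).
record EdgeColouring (m n r : ℕ) : Set where
  field
    col     : Vtx m n → Vtx m n → Fin r
    col-sym : ∀ u v → col u v ≡ col v u
open EdgeColouring public

Triple : ℕ → ℕ → Set
Triple m n = Vtx m n × Vtx m n × Vtx m n

IsTriangle : ∀ {m n} → TripartiteGraph m n → Triple m n → Set
IsTriangle G (x , y , z) = Adj G x y × Adj G y z × Adj G x z

IsMonoTriangle : ∀ {m n r} → TripartiteGraph m n → EdgeColouring m n r → Triple m n → Set
IsMonoTriangle G χ t@(x , y , z) =
  IsTriangle G t × (col χ x y ≡ col χ y z) × (col χ x y ≡ col χ x z)

SameEdge : ∀ {m n} → Vtx m n × Vtx m n → Vtx m n × Vtx m n → Set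
SameEdge (a , b) (c , d) = (a ≡ c × b ≡ d) ⊎ (a ≡ d × b ≡ c)

EdgeOf : ∀ {m n} → Vtx m n × Vtx m n → Triple m n → Set
EdgeOf e (x , y , z) = SameEdge e (x , y) ⊎ SameEdge e (y , z) ⊎ SameEdge e (x , z)

HasMonoDiamond : ∀ {m n r} → TripartiteGraph m n → EdgeColouring m n r → Set
HasMonoDiamond G χ =
  Σ (Vtx _ _) λ u → Σ (Vtx _ _) λ v → Σ (Vtx _ _) λ w → Σ (Vtx _ _) λ w' →
    (w ≢ w') × IsMonoTriangle G χ (u , v , w) × IsMonoTriangle G χ (u , v , w')

module Submission where

-- For b ∈ V₁ and c ∈ V₂ let apex b c ∈ V₀ be the third vertex of a covering triangle on bc,
-- and colour b c its colour.  If pairs (b, c) and (b′, c′) have the same apex a and colour k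
-- and the edge bc′ (c′ ≠ c) also has colour k, the triangles abc and abc′ form a diamond on ab;
-- symmetrically on ac.  Absent such diamonds we run a density argument.  Keep B ⊆ V₁ and
-- C ⊆ V₂ of size at least s and a set U of used colours such that every b ∈ B sees at most |U|
-- vertices of C through edges coloured in U.  Then B × C contains at least s (s − |U|) pairs
-- of a new colour; by pigeonhole at least s (s − |U|) / (m r) of them share an apex and a
-- colour k ∉ U, and these form a matching, since a second pair in a row or column would give a
-- diamond.  Its rows and columns are the next B and C, with U ∪ {k}.  So each step takes s to
-- at least s² / (2 m r), and the bound on n keeps s > 2 r for r + 1 steps, at which point more
-- than r colours would have been used.

open import Defs
open import Data.Bool using (Bool; true; false; _∧_; _∨_; not)
open import Data.Bool.Properties using (∧-identityʳ; ∧-zeroʳ; ∧-distribˡ-∨)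
open import Data.Empty using (⊥; ⊥-elim)
open import Data.Fin using (Fin; zero; suc; combine)
open import Data.Fin.Properties using (_≟_; suc-injective; 0≢1+n; combine-injective; any?)
open import Data.Nat
  using (ℕ; zero; suc; _+_; _*_; _∸_; _^_; _≤_; _<_; z≤n; s≤s; z<s; _<?_; NonZero; >-nonZero; >-nonZero⁻¹)
open import Data.Nat.Properties
  using ( module ≤-Reasoning; +-0-commutativeMonoid; *-commutativeSemigroup; +-mono-≤
        ; *-distribʳ-+; ≤-refl; ≤-total; +-monoʳ-≤; ≤-trans; *-monoʳ-≤; m≤m+n; ≤-reflexive
        ; +-comm; +-identityʳ; ≮⇒≥; [m*n]*[o*p]≡[m*o]*[n*p]; ^-distribˡ-+-*; m^n>0; *-cancelˡ-≤
        ; m^n≢0; ^-monoˡ-≤; *-assoc; *-comm; *-monoʳ-<; m<n+m; *-mono-≤; ≰⇒>; <⇒≱; *-cancelˡ-<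
        ; <⇒≤; *-suc; +-monoˡ-≤; n≤1+n; <-irrefl; ^-*-assoc; ^-monoˡ-<; ^-monoʳ-≤; m*n≢0
        ; m+n≤o⇒m≤o; m+n≤o⇒m≤o∸n; m∸n+n≡m; n<1+n; m+n∸m≡n; ∸-mono; *-identityˡ; *-monoˡ-≤
        ; ≤-<-trans; *-mono-<; m<n⇒0<n∸m; m*n≢0⇒n≢0; m≤n*m; +-suc
        )
open import Data.Product using (_×_; _,_; Σ; ∃; ∃₂; proj₁; proj₂)
import Data.Product as Product
open import Data.Sum using (_⊎_; inj₁; inj₂; [_,_]′)
open import Function using (_∘_; id)
open import Relation.Binary.PropositionalEquality
  using (_≡_; _≢_; refl; sym; trans; cong; cong₂; subst; subst₂; module ≡-Reasoning)
open import Relation.Nullary using (¬_; Dec; yes; no; does; contradiction; _×-dec_; _⊎-dec_; ¬?)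
open import Relation.Nullary.Decidable using (decidable-stable)
open import Algebra.Properties.CommutativeMonoid.Sum +-0-commutativeMonoid
  using (sum; sum-syntax; ∑-comm; ∑-distrib-+; sum-cong-≗; sum-replicate-zero)
open import Algebra.Properties.CommutativeSemigroup *-commutativeSemigroup using (x∙yz≈y∙xz)

-- Finite sums and counting

does-true : ∀ {a} {A : Set a} (a? : Dec A) → does a? ≡ true → A
does-true (yes a) _ = a

∧-true : ∀ x {y} → x ∧ y ≡ true → x ≡ true × y ≡ true
∧-true true y≡true = refl , y≡true

∑-mono-≤ : ∀ {k} {f g : Fin k → ℕ} → (∀ i → f i ≤ g i) → sum f ≤ sum g
∑-mono-≤ {zero}  f≤g = z≤n
∑-mono-≤ {suc k} f≤g = +-mono-≤ (f≤g zero) (∑-mono-≤ (f≤g ∘ suc))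

∑-distribʳ-* : ∀ {k} (f : Fin k → ℕ) c → ∑[ i < k ] (f i * c) ≡ sum f * c
∑-distribʳ-* {zero}  f c = refl
∑-distribʳ-* {suc k} f c =
  trans (cong (f zero * c +_) (∑-distribʳ-* (f ∘ suc) c)) (sym (*-distribʳ-+ c (f zero) _))

∃-term≥average : ∀ {k} .{{_ : NonZero k}} (g : Fin k → ℕ) → ∃ λ i → sum g ≤ k * g i
∃-term≥average {suc zero}    g = zero , ≤-refl
∃-term≥average {suc (suc k)} g with ∃-term≥average (g ∘ suc)
... | i , ∑≤ with ≤-total (g zero) (g (suc i))
...   | inj₁ g₀≤gᵢ = suc i , +-mono-≤ g₀≤gᵢ ∑≤
...   | inj₂ gᵢ≤g₀ = zero  , +-monoʳ-≤ (g zero) (≤-trans ∑≤ (*-monoʳ-≤ (suc k) gᵢ≤g₀))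

∃-positive-term : ∀ {k} (g : Fin k → ℕ) → 0 < sum g → ∃ λ i → 0 < g i
∃-positive-term {suc k} g 0<∑ with g zero in g₀≡
... | suc _ = zero , subst (0 <_) (sym g₀≡) z<s
... | zero  = Product.map suc id (∃-positive-term (g ∘ suc) 0<∑)

𝟙 : Bool → ℕ
𝟙 true  = 1
𝟙 false = 0

count : ∀ {k} → (Fin k → Bool) → ℕ
count {k} p = ∑[ i < k ] 𝟙 (p i)

count₂ : ∀ {k l} → (Fin k → Fin l → Bool) → ℕ
count₂ {k} P = ∑[ i < k ] count (P i)

count≤n : ∀ {k} (p : Fin k → Bool) → count p ≤ k
count≤n {zero}  p = z≤n
count≤n {suc k} p = +-mono-≤ (𝟙≤1 (p zero)) (count≤n (p ∘ suc))
  where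
  𝟙≤1 : ∀ x → 𝟙 x ≤ 1
  𝟙≤1 true  = ≤-refl
  𝟙≤1 false = z≤n

count-none : ∀ {k} (p : Fin k → Bool) → (∀ i → p i ≡ false) → count p ≡ 0
count-none {k} p none = trans (sum-cong-≗ (cong 𝟙 ∘ none)) (sum-replicate-zero k)

count-cong : ∀ {k} {p q : Fin k → Bool} → (∀ i → p i ≡ q i) → count p ≡ count q
count-cong p≗q = sum-cong-≗ (cong 𝟙 ∘ p≗q)

count-all : ∀ {k} → count {k} (λ _ → true) ≡ k
count-all {zero}  = refl
count-all {suc k} = cong suc (count-all {k})

count-mono : ∀ {k} {p q : Fin k → Bool} → (∀ i → p i ≡ true → q i ≡ true) → count p ≤ count q
count-mono {p = p} {q} p⊆q = ∑-mono-≤ λ i → 𝟙-mono (p i) (q i) (p⊆q i)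
  where
  𝟙-mono : ∀ x y → (x ≡ true → y ≡ true) → 𝟙 x ≤ 𝟙 y
  𝟙-mono false y     _   = z≤n
  𝟙-mono true  true  _   = ≤-refl
  𝟙-mono true  false x⇒y = contradiction (x⇒y refl) λ ()

count-∨-∧ : ∀ {k} (p q : Fin k → Bool) →
  count (λ i → p i ∨ q i) + count (λ i → p i ∧ q i) ≡ count p + count q
count-∨-∧ p q = begin
  count (λ i → p i ∨ q i) + count (λ i → p i ∧ q i) ≡⟨ ∑-distrib-+ (λ i → 𝟙 (p i ∨ q i)) _ ⟨
  sum (λ i → 𝟙 (p i ∨ q i) + 𝟙 (p i ∧ q i))         ≡⟨ sum-cong-≗ (λ i → pointwise (p i) (q i)) ⟩
  sum (λ i → 𝟙 (p i) + 𝟙 (q i))                     ≡⟨ ∑-distrib-+ (𝟙 ∘ p) (𝟙 ∘ q) ⟩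
  count p + count q                                 ∎
  where
  open ≡-Reasoning
  pointwise : ∀ x y → 𝟙 (x ∨ y) + 𝟙 (x ∧ y) ≡ 𝟙 x + 𝟙 y
  pointwise true  true  = refl
  pointwise true  false = refl
  pointwise false true  = refl
  pointwise false false = refl

count-∨-≤ : ∀ {k} (p q : Fin k → Bool) → count (λ i → p i ∨ q i) ≤ count p + count q
count-∨-≤ p q = ≤-trans (m≤m+n _ _) (≤-reflexive (count-∨-∧ p q))

count-partition : ∀ {k} (p q : Fin k → Bool) →
  count p ≡ count (λ i → p i ∧ q i) + count (λ i → p i ∧ not (q i))
count-partition p q =
  trans (sum-cong-≗ (λ i → pointwise (p i) (q i))) (∑-distrib-+ (λ i → 𝟙 (p i ∧ q i)) _)
  where
  pointwise : ∀ x y → 𝟙 x ≡ 𝟙 (x ∧ y) + 𝟙 (x ∧ not y)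
  pointwise true  true  = refl
  pointwise true  false = refl
  pointwise false y     = refl

count-singleton : ∀ {k} (x : Fin k) → count (λ y → does (x ≟ y)) ≡ 1
count-singleton {suc k} zero    = cong suc (count-none {k} _ (λ _ → refl))
count-singleton         (suc x) = count-singleton x

count-insert : ∀ {k} (p : Fin k → Bool) x → p x ≡ false →
  count (λ y → p y ∨ does (x ≟ y)) ≡ suc (count p)
count-insert p x px≡false = begin
  count (λ y → p y ∨ does (x ≟ y))                                    ≡⟨ +-identityʳ _ ⟨
  count (λ y → p y ∨ does (x ≟ y)) + 0                                ≡⟨ cong (count (λ y → p y ∨ does (x ≟ y)) +_) (count-none _ disjoint) ⟨
  count (λ y → p y ∨ does (x ≟ y)) + count (λ y → p y ∧ does (x ≟ y)) ≡⟨ count-∨-∧ p (λ y → does (x ≟ y)) ⟩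
  count p + count (λ y → does (x ≟ y))                                ≡⟨ cong (count p +_) (count-singleton x) ⟩
  count p + 1                                                         ≡⟨ +-comm (count p) 1 ⟩
  suc (count p)                                                       ∎
  where
  open ≡-Reasoning
  disjoint : ∀ y → p y ∧ does (x ≟ y) ≡ false
  disjoint y with x ≟ y
  ... | yes refl = trans (∧-identityʳ (p x)) px≡false
  ... | no  _    = ∧-zeroʳ (p y)

count-by-key : ∀ {k q} (p : Fin k → Bool) (key : Fin k → Fin q) →
  count p ≡ ∑[ x < q ] count (λ i → p i ∧ does (key i ≟ x))
count-by-key p key =
  trans (sum-cong-≗ (λ i → split (p i) (key i))) (∑-comm (λ i x → 𝟙 (p i ∧ does (key i ≟ x))))
  where
  split : ∀ {q} b (y : Fin q) → 𝟙 b ≡ count (λ x → b ∧ does (y ≟ x))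
  split true  y = sym (count-singleton y)
  split false y = sym (count-none (λ x → false ∧ does (y ≟ x)) (λ _ → refl))

count₂-by-key : ∀ {k l q} (P : Fin k → Fin l → Bool) (key : Fin k → Fin l → Fin q) →
  count₂ P ≡ ∑[ x < q ] count₂ (λ i j → P i j ∧ does (key i j ≟ x))
count₂-by-key P key =
  trans (sum-cong-≗ (λ i → count-by-key (P i) (key i)))
        (∑-comm (λ i x → count (λ j → P i j ∧ does (key i j ≟ x))))

AtMostOne : ∀ {k} → (Fin k → Bool) → Set
AtMostOne p = ∀ i j → p i ≡ true → p j ≡ true → i ≡ j

count≤1 : ∀ {k} {p : Fin k → Bool} → AtMostOne p → count p ≤ 1
count≤1 {zero}          _   = z≤n
count≤1 {suc k} {p} one with p zero in p₀
... | true  = ≤-reflexive (cong suc (count-none (p ∘ suc) rest-empty))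
  where
  rest-empty : ∀ i → p (suc i) ≡ false
  rest-empty i with p (suc i) in pᵢ
  ... | true  = contradiction (one zero (suc i) p₀ pᵢ) 0≢1+n
  ... | false = refl
... | false = count≤1 (λ i j pᵢ pⱼ → suc-injective (one (suc i) (suc j) pᵢ pⱼ))

count-positive⇒∃ : ∀ {k} (p : Fin k → Bool) → 0 < count p → ∃ λ i → p i ≡ true
count-positive⇒∃ p 0<∣p∣ = Product.map₂ 𝟙-positive (∃-positive-term (𝟙 ∘ p) 0<∣p∣)
  where
  𝟙-positive : ∀ {x} → 0 < 𝟙 x → x ≡ true
  𝟙-positive {true} _ = refl

nonempty : ∀ {k} → (Fin k → Bool) → Bool
nonempty p = does (0 <? count p)

nonempty⇒∃ : ∀ {k} (p : Fin k → Bool) → nonempty p ≡ true → ∃ λ i → p i ≡ true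
nonempty⇒∃ p ne = count-positive⇒∃ p (does-true (0 <? count p) ne)

count≤𝟙-nonempty : ∀ {k} {p : Fin k → Bool} → AtMostOne p → count p ≤ 𝟙 (nonempty p)
count≤𝟙-nonempty {p = p} one = bound (0 <? count p)
  where
  bound : (0<∣p∣? : Dec (0 < count p)) → count p ≤ 𝟙 (does 0<∣p∣?)
  bound (yes _)     = count≤1 one
  bound (no  ∣p∣≯0) = ≮⇒≥ ∣p∣≯0

-- The growth condition

^-distribʳ-* : ∀ a b k → (a * b) ^ k ≡ a ^ k * b ^ k
^-distribʳ-* a b zero    = refl
^-distribʳ-* a b (suc k) =
  trans (cong (a * b *_) (^-distribʳ-* a b k)) ([m*n]*[o*p]≡[m*o]*[n*p] a b (a ^ k) (b ^ k))

^-double : ∀ a k → a ^ (2 * k) ≡ a ^ k * a ^ k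
^-double a k = trans (^-distribˡ-+-* a k (k + 0)) (cong (λ l → a ^ k * a ^ l) (+-identityʳ k))

n<2^n : ∀ n → n < 2 ^ n
n<2^n zero    = s≤s z≤n
n<2^n (suc n) = +-mono-≤ (m^n>0 2 n) (≤-trans (n<2^n n) (m≤m+n (2 ^ n) 0))

-- (s / Y) ^ F ≥ β / Y with the denominators cleared.
Large : (Y β F s : ℕ) → Set
Large Y β F s = Y ^ F * β ≤ Y * s ^ F

module _ {Y : ℕ} .{{_ : NonZero Y}} where

  Large-square : ∀ {β F s s′} → s * s ≤ Y * s′ → Large Y β (2 * F) s → Large Y β F s′
  Large-square {β} {F} {s} {s′} s²≤Ys′ large = *-cancelˡ-≤ (Y ^ F) {{m^n≢0 Y F}} (begin
    Y ^ F * (Y ^ F * β)  ≡⟨ *-assoc (Y ^ F) (Y ^ F) β ⟨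
    Y ^ F * Y ^ F * β    ≡⟨ cong (_* β) (^-double Y F) ⟨
    Y ^ (2 * F) * β      ≤⟨ large ⟩
    Y * s ^ (2 * F)      ≡⟨ cong (Y *_) (trans (^-double s F) (sym (^-distribʳ-* s s F))) ⟩
    Y * (s * s) ^ F      ≤⟨ *-monoʳ-≤ Y (^-monoˡ-≤ F s²≤Ys′) ⟩
    Y * (Y * s′) ^ F     ≡⟨ cong (Y *_) (^-distribʳ-* Y s′ F) ⟩
    Y * (Y ^ F * s′ ^ F) ≡⟨ x∙yz≈y∙xz Y (Y ^ F) (s′ ^ F) ⟩
    Y ^ F * (Y * s′ ^ F) ∎)
    where open ≤-Reasoning

  Large⇒> : ∀ {x F s} .{{_ : NonZero F}} → x ≤ Y → Large Y (suc x) F s → x < s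
  Large⇒> {x} {suc e} {s} x≤Y large = ≰⇒> λ s≤x → <⇒≱ (small s≤x) large
    where
    open ≤-Reasoning
    small : s ≤ x → Y * s ^ suc e < Y ^ suc e * suc x
    small s≤x = begin-strict
      Y * (s * s ^ e)     ≤⟨ *-monoʳ-≤ Y (*-mono-≤ s≤x (^-monoˡ-≤ e (≤-trans s≤x x≤Y))) ⟩
      Y * (x * Y ^ e)     <⟨ *-monoʳ-< Y (m<n+m (x * Y ^ e) (m^n>0 Y e)) ⟩
      Y * (suc x * Y ^ e) ≡⟨ cong (Y *_) (*-comm (suc x) (Y ^ e)) ⟩
      Y * (Y ^ e * suc x) ≡⟨ *-assoc Y (Y ^ e) (suc x) ⟨
      Y * Y ^ e * suc x   ∎

  -- ℕ has no K-th roots, so argue by contradiction: failure means n ^ K < (2 Y) ^ (K − 1), and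
  -- raising this to the power K + 1 contradicts the hypothesis raised to the power K.
  Large-initial : ∀ {β K n} → β < K → (2 * Y) ^ K < n ^ suc K → Large Y β K n
  Large-initial {β} {suc e} {n} (s≤s β≤e) hyp = ≮⇒≥ λ small → nᴷ≮Xᵉ (too-small small)
    where
    open ≤-Reasoning
    K X : ℕ
    K = suc e
    X = 2 * Y
    too-small : Y * n ^ K < Y ^ K * β → n ^ K < X ^ e
    too-small small = *-cancelˡ-< Y (n ^ K) (X ^ e) (begin-strict
      Y * n ^ K           <⟨ small ⟩
      Y * Y ^ e * β       ≡⟨ *-assoc Y (Y ^ e) β ⟩
      Y * (Y ^ e * β)     ≤⟨ *-monoʳ-≤ Y (*-monoʳ-≤ (Y ^ e) (≤-trans β≤e (<⇒≤ (n<2^n e)))) ⟩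
      Y * (Y ^ e * 2 ^ e) ≡⟨ cong (Y *_) (trans (*-comm (Y ^ e) (2 ^ e)) (sym (^-distribʳ-* 2 Y e))) ⟩
      Y * X ^ e           ∎)
    eK+e≤KK : e * suc K ≤ K * K
    eK+e≤KK = ≤-trans (≤-reflexive (*-suc e K)) (+-monoˡ-≤ (e * K) (n≤1+n e))
    nᴷ≮Xᵉ : ¬ (n ^ K < X ^ e)
    nᴷ≮Xᵉ nᴷ<Xᵉ = <-irrefl refl (begin-strict
      (n ^ K) ^ suc K ≤⟨ <⇒≤ (^-monoˡ-< (suc K) nᴷ<Xᵉ) ⟩
      (X ^ e) ^ suc K ≡⟨ ^-*-assoc X e (suc K) ⟩
      X ^ (e * suc K) ≤⟨ ^-monoʳ-≤ X {{m*n≢0 2 Y}} eK+e≤KK ⟩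
      X ^ (K * K)     ≡⟨ ^-*-assoc X K K ⟨
      (X ^ K) ^ K     <⟨ ^-monoˡ-< K hyp ⟩
      (n ^ suc K) ^ K ≡⟨ ^-*-assoc n (suc K) K ⟩
      n ^ (suc K * K) ≡⟨ cong (n ^_) (*-comm (suc K) K) ⟩
      n ^ (K * suc K) ≡⟨ ^-*-assoc n K (suc K) ⟨
      (n ^ K) ^ suc K ∎)

2*m<n⇒n≤2*[n∸m] : ∀ {m n} → 2 * m < n → n ≤ 2 * (n ∸ m)
2*m<n⇒n≤2*[n∸m] {m} {n} 2m<n = begin
  n                     ≡⟨ m∸n+n≡m m≤n ⟨
  (n ∸ m) + m           ≤⟨ +-monoʳ-≤ (n ∸ m) (m+n≤o⇒m≤o∸n m m+m≤n) ⟩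
  (n ∸ m) + (n ∸ m)     ≡⟨ cong ((n ∸ m) +_) (+-identityʳ (n ∸ m)) ⟨
  2 * (n ∸ m)           ∎
  where
  open ≤-Reasoning
  m+m≤n : m + m ≤ n
  m+m≤n = ≤-trans (≤-reflexive (cong (m +_) (sym (+-identityʳ m)))) (<⇒≤ 2m<n)
  m≤n : m ≤ n
  m≤n = m+n≤o⇒m≤o m m+m≤n

2n+1<2^[n+3] : ∀ n → suc (2 * n) < 2 ^ (n + 3)
2n+1<2^[n+3] n = begin-strict
  suc (2 * n)  <⟨ n<1+n (suc (2 * n)) ⟩
  2 + 2 * n    ≡⟨ *-suc 2 n ⟨
  2 * suc n    ≤⟨ *-monoʳ-≤ 2 (n<2^n n) ⟩
  2 ^ suc n    ≤⟨ ^-monoʳ-≤ 2 (≤-trans (≤-reflexive (+-comm 1 n)) (+-monoʳ-≤ n (s≤s z≤n))) ⟩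
  2 ^ (n + 3)  ∎
  where open ≤-Reasoning

-- Apex colourings of V₁ × V₂

-- apex b c ∈ V₀ closes a monochromatic triangle of colour colour b c on the edge bc.  A row
-- diamond is a pair of such triangles on an edge {apex, b}, the second one being (apex, b, c′):
-- its edge from apex to c′ comes from the triangle on b′c′.  A column diamond is the same on an
-- edge {apex, c}.
module _ {m n r : ℕ} (apex : Fin n → Fin n → Fin m) (colour : Fin n → Fin n → Fin r) where

  RowDiamond : Set
  RowDiamond = ∃₂ λ b c → ∃₂ λ b′ c′ →
    apex b c ≡ apex b′ c′ × colour b c ≡ colour b′ c′ × c ≢ c′ × colour b c′ ≡ colour b c

  ColumnDiamond : Set
  ColumnDiamond = ∃₂ λ b c → ∃₂ λ b′ c′ →
    apex b c ≡ apex b′ c′ × colour b c ≡ colour b′ c′ × b ≢ b′ × colour b′ c ≡ colour b c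

  RowDiamond? : Dec RowDiamond
  RowDiamond? = any? λ b → any? λ c → any? λ b′ → any? λ c′ →
    (apex b c ≟ apex b′ c′) ×-dec (colour b c ≟ colour b′ c′) ×-dec ¬? (c ≟ c′) ×-dec
    (colour b c′ ≟ colour b c)

  ColumnDiamond? : Dec ColumnDiamond
  ColumnDiamond? = any? λ b → any? λ c → any? λ b′ → any? λ c′ →
    (apex b c ≟ apex b′ c′) ×-dec (colour b c ≟ colour b′ c′) ×-dec ¬? (b ≟ b′) ×-dec
    (colour b′ c ≟ colour b c)

  -- U is the set of colours used so far.
  record Invariant (U : Fin r → Bool) (B C : Fin n → Bool) (s : ℕ) : Set where
    field
      s≤∣B∣       : s ≤ count B
      s≤∣C∣       : s ≤ count C
      few-U-edges : ∀ b → B b ≡ true → count (λ c → C c ∧ U (colour b c)) ≤ count U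

  module _ .{{_ : NonZero m}} .{{_ : NonZero r}} where

    Y : ℕ
    Y = 2 * (m * r)

    instance
      m*r≢0 : NonZero (m * r)
      m*r≢0 = m*n≢0 m r
      Y≢0 : NonZero Y
      Y≢0 = m*n≢0 2 (m * r)

    record Successor (U : Fin r → Bool) (s : ℕ) : Set where
      field
        {U′}      : Fin r → Bool
        {B′ C′}   : Fin n → Bool
        {s′}      : ℕ
        invariant : Invariant U′ B′ C′ s′
        one-more  : count U′ ≡ suc (count U)
        s²≤Ys′    : s * s ≤ Y * s′

    module _ (no-row : ¬ RowDiamond) (no-column : ¬ ColumnDiamond) where

      module Step {U B C s} (inv : Invariant U B C s) (2∣U∣<s : 2 * count U < s) where

        open Invariant inv

        j : ℕ
        j = count U

        fresh : Fin n → Fin n → Bool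
        fresh b c = B b ∧ (C c ∧ not (U (colour b c)))

        fresh-row : ∀ b → 𝟙 (B b) * (s ∸ j) ≤ count (fresh b)
        fresh-row b with B b in Bb
        ... | false = z≤n
        ... | true  = begin
          1 * (s ∸ j)      ≡⟨ *-identityˡ (s ∸ j) ⟩
          s ∸ j            ≤⟨ ∸-mono s≤∣C∣ (few-U-edges b Bb) ⟩
          count C ∸ old    ≡⟨ cong (_∸ old) (count-partition C (U ∘ colour b)) ⟩
          old + new ∸ old  ≡⟨ m+n∸m≡n old new ⟩
          new              ∎
          where
          open ≤-Reasoning
          old new : ℕ
          old = count (λ c → C c ∧ U (colour b c))
          new = count (λ c → C c ∧ not (U (colour b c)))

        many-fresh : s * (s ∸ j) ≤ count₂ fresh
        many-fresh = begin
          s * (s ∸ j)                   ≤⟨ *-monoˡ-≤ (s ∸ j) s≤∣B∣ ⟩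
          count B * (s ∸ j)             ≡⟨ ∑-distribʳ-* (𝟙 ∘ B) (s ∸ j) ⟨
          sum (λ b → 𝟙 (B b) * (s ∸ j)) ≤⟨ ∑-mono-≤ fresh-row ⟩
          count₂ fresh                  ∎
          where open ≤-Reasoning

        key : Fin n → Fin n → Fin (m * r)
        key b c = combine (apex b c) (colour b c)

        class : Fin (m * r) → Fin n → Fin n → Bool
        class x b c = fresh b c ∧ does (key b c ≟ x)

        heaviest : ∃ λ x → count₂ fresh ≤ m * r * count₂ (class x)
        heaviest = Product.map₂ (≤-trans (≤-reflexive (count₂-by-key fresh key)))
                     (∃-term≥average (λ x → count₂ (class x)))

        P : Fin n → Fin n → Bool
        P = class (proj₁ heaviest)

        N : ℕ
        N = count₂ P

        P-facts : ∀ {b c} → P b c ≡ true →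
          B b ≡ true × C c ≡ true × U (colour b c) ≡ false × key b c ≡ proj₁ heaviest
        P-facts {b} {c} Pbc =
          let fresh-bc , key≡ = ∧-true (fresh b c) Pbc
              Bb , C-and-new  = ∧-true (B b) fresh-bc
              Cc , new        = ∧-true (C c) C-and-new
          in  Bb , Cc , not-true new , does-true (key b c ≟ proj₁ heaviest) key≡
          where
          not-true : ∀ {x} → not x ≡ true → x ≡ false
          not-true {false} _ = refl

        same-class : ∀ {b c b′ c′} → P b c ≡ true → P b′ c′ ≡ true →
          apex b c ≡ apex b′ c′ × colour b c ≡ colour b′ c′
        same-class Pbc Pb′c′ =
          let _ , _ , _ , key≡  = P-facts Pbc
              _ , _ , _ , key≡′ = P-facts Pb′c′
          in  combine-injective _ _ _ _ (trans key≡ (sym key≡′))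

        row-unique : ∀ {b c b′ c′} → P b c ≡ true → P b′ c′ ≡ true →
          colour b c′ ≡ colour b c → c ≡ c′
        row-unique {b} {c} {b′} {c′} Pbc Pb′c′ cross = decidable-stable (c ≟ c′) λ c≢c′ →
          let same-apex , same-colour = same-class Pbc Pb′c′
          in  no-row (b , c , b′ , c′ , same-apex , same-colour , c≢c′ , cross)

        column-unique : ∀ {b c b′ c′} → P b c ≡ true → P b′ c′ ≡ true →
          colour b′ c ≡ colour b c → b ≡ b′
        column-unique {b} {c} {b′} {c′} Pbc Pb′c′ cross = decidable-stable (b ≟ b′) λ b≢b′ →
          let same-apex , same-colour = same-class Pbc Pb′c′
          in  no-column (b , c , b′ , c′ , same-apex , same-colour , b≢b′ , cross)

        0<N : 0 < N
        0<N = >-nonZero⁻¹ N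
          where
          j<s : j < s
          j<s = ≤-<-trans (m≤m+n j (j + 0)) 2∣U∣<s
          0<mrN : 0 < m * r * N
          0<mrN = ≤-trans (*-mono-< (≤-<-trans z≤n j<s) (m<n⇒0<n∸m j<s))
                    (≤-trans many-fresh (proj₂ heaviest))
          instance
            N≢0 : NonZero N
            N≢0 = m*n≢0⇒n≢0 (m * r) {{>-nonZero 0<mrN}}

        b₀ : Fin n
        b₀ = proj₁ (∃-positive-term (count ∘ P) 0<N)

        c₀ : ∃ λ c → P b₀ c ≡ true
        c₀ = count-positive⇒∃ (P b₀) (proj₂ (∃-positive-term (count ∘ P) 0<N))

        k : Fin r
        k = colour b₀ (proj₁ c₀)

        P⇒k : ∀ {b c} → P b c ≡ true → colour b c ≡ k
        P⇒k Pbc = proj₂ (same-class Pbc (proj₂ c₀))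

        Uk≡false : U k ≡ false
        Uk≡false = let _ , _ , new , _ = P-facts (proj₂ c₀) in new

        U′ : Fin r → Bool
        U′ y = U y ∨ does (k ≟ y)

        B′ C′ : Fin n → Bool
        B′ b = nonempty (P b)
        C′ c = nonempty (λ b → P b c)

        N≤∣B′∣ : N ≤ count B′
        N≤∣B′∣ = ∑-mono-≤ λ b → count≤𝟙-nonempty λ c c′ Pbc Pbc′ →
          row-unique {b′ = b} Pbc Pbc′ (trans (P⇒k Pbc′) (sym (P⇒k Pbc)))

        N≤∣C′∣ : N ≤ count C′
        N≤∣C′∣ = ≤-trans (≤-reflexive (∑-comm (λ b c → 𝟙 (P b c)))) (∑-mono-≤ λ c →
          count≤𝟙-nonempty λ b b′ Pbc Pb′c →
            column-unique {c′ = c} Pbc Pb′c (trans (P⇒k Pb′c) (sym (P⇒k Pbc))))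

        few-U′-edges : ∀ b → B′ b ≡ true → count (λ c → C′ c ∧ U′ (colour b c)) ≤ count U′
        few-U′-edges b B′b = begin
          count (λ c → C′ c ∧ U′ (colour b c))
            ≡⟨ count-cong (λ c → ∧-distribˡ-∨ (C′ c) (U (colour b c)) (k-coloured c)) ⟩
          count (λ c → C′ c ∧ U (colour b c) ∨ C′ c ∧ k-coloured c)
            ≤⟨ count-∨-≤ (λ c → C′ c ∧ U (colour b c)) (λ c → C′ c ∧ k-coloured c) ⟩
          count (λ c → C′ c ∧ U (colour b c)) + count (λ c → C′ c ∧ k-coloured c)
            ≤⟨ +-mono-≤ (count-mono C′U⊆CU) (count≤1 at-most-one-k) ⟩
          count (λ c → C c ∧ U (colour b c)) + 1
            ≤⟨ +-monoˡ-≤ 1 (few-U-edges b (proj₁ (P-facts Pbcb))) ⟩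
          j + 1
            ≡⟨ +-comm j 1 ⟩
          suc j
            ≡⟨ count-insert U k Uk≡false ⟨
          count U′ ∎
          where
          open ≤-Reasoning
          k-coloured : Fin n → Bool
          k-coloured c = does (k ≟ colour b c)
          cb : Fin n
          cb = proj₁ (nonempty⇒∃ (P b) B′b)
          Pbcb : P b cb ≡ true
          Pbcb = proj₂ (nonempty⇒∃ (P b) B′b)
          C′U⊆CU : ∀ c → C′ c ∧ U (colour b c) ≡ true → C c ∧ U (colour b c) ≡ true
          C′U⊆CU c h =
            let C′c , Ucbc = ∧-true (C′ c) h
                _ , Cc , _ = P-facts (proj₂ (nonempty⇒∃ (λ b → P b c) C′c))
            in  cong₂ _∧_ Cc Ucbc
          k-edge⇒cb : ∀ {c} → C′ c ∧ k-coloured c ≡ true → cb ≡ c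
          k-edge⇒cb {c} h =
            let C′c , k≡ = ∧-true (C′ c) h
            in  row-unique Pbcb (proj₂ (nonempty⇒∃ (λ b → P b c) C′c))
                  (trans (sym (does-true (k ≟ colour b c) k≡)) (sym (P⇒k Pbcb)))
          at-most-one-k : AtMostOne (λ c → C′ c ∧ k-coloured c)
          at-most-one-k c c′ h h′ = trans (sym (k-edge⇒cb h)) (k-edge⇒cb h′)

        s²≤YN : s * s ≤ Y * N
        s²≤YN = begin
          s * s             ≤⟨ *-monoʳ-≤ s (2*m<n⇒n≤2*[n∸m] {j} 2∣U∣<s) ⟩
          s * (2 * (s ∸ j)) ≡⟨ x∙yz≈y∙xz s 2 (s ∸ j) ⟩
          2 * (s * (s ∸ j)) ≤⟨ *-monoʳ-≤ 2 (≤-trans many-fresh (proj₂ heaviest)) ⟩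
          2 * (m * r * N)   ≡⟨ *-assoc 2 (m * r) N ⟨
          Y * N             ∎
          where open ≤-Reasoning

      successor : ∀ {U B C s} → Invariant U B C s → 2 * count U < s → Successor U s
      successor {U} inv 2∣U∣<s = record
        { U′ = U′ ; B′ = B′ ; C′ = C′ ; s′ = N
        ; invariant = record { s≤∣B∣ = N≤∣B′∣ ; s≤∣C∣ = N≤∣C′∣ ; few-U-edges = few-U′-edges }
        ; one-more  = count-insert U k Uk≡false
        ; s²≤Ys′    = s²≤YN
        }
        where open Step inv 2∣U∣<s

      β : ℕ
      β = suc (2 * r)

      Large⇒2∣U∣<s : ∀ {e t} {U : Fin r → Bool} {s} →
        count U + t ≡ r → Large Y β (2 ^ (t + e)) s → 2 * count U < s
      Large⇒2∣U∣<s {e} {t} {U} {s} used large =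
        ≤-<-trans (*-monoʳ-≤ 2 ∣U∣≤r) (Large⇒> {F = 2 ^ (t + e)} {s} (*-monoʳ-≤ 2 (m≤n*m r m)) large)
        where
        instance
          2^[t+e]≢0 : NonZero (2 ^ (t + e))
          2^[t+e]≢0 = m^n≢0 2 (t + e)
        ∣U∣≤r : count U ≤ r
        ∣U∣≤r = subst (count U ≤_) used (m≤m+n (count U) t)

      no-large-invariant : ∀ e t {U B C s} →
        count U + t ≡ r → Invariant U B C s → Large Y β (2 ^ (t + e)) s → ⊥
      no-large-invariant e zero {U} used inv large = <⇒≱ r<∣U′∣ (count≤n U′)
        where
        open Successor (successor inv (Large⇒2∣U∣<s {e} {zero} {U} used large))
        r<∣U′∣ : r < count U′
        r<∣U′∣ = subst (λ x → suc x ≤ count U′) (trans (sym (+-identityʳ (count U))) used)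
                   (≤-reflexive (sym one-more))
      no-large-invariant e (suc t) {U} used inv large =
        no-large-invariant e t (trans (cong (_+ t) one-more) (trans (sym (+-suc (count U) t)) used))
          invariant (Large-square {F = 2 ^ (t + e)} s²≤Ys′ large)
        where open Successor (successor inv (Large⇒2∣U∣<s {e} {suc t} {U} used large))

  apex-colouring-has-diamond : .{{_ : NonZero m}} .{{_ : NonZero r}} →
    (4 * m * r) ^ (2 ^ (r + 3)) < n ^ (1 + 2 ^ (r + 3)) → RowDiamond ⊎ ColumnDiamond
  apex-colouring-has-diamond hyp =
    decidable-stable (RowDiamond? ⊎-dec ColumnDiamond?) λ no-diamond →
      no-large-invariant (no-diamond ∘ inj₁) (no-diamond ∘ inj₂) 3 r
        (cong (_+ r) none-used) everything
        (Large-initial (2n+1<2^[n+3] r) (subst (λ X → X ^ K < n ^ suc K) 4mr≡2Y hyp))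
    where
    K : ℕ
    K = 2 ^ (r + 3)
    none-used : count {r} (λ _ → false) ≡ 0
    none-used = count-none {r} (λ _ → false) (λ _ → refl)
    everything : Invariant (λ _ → false) (λ _ → true) (λ _ → true) n
    everything = record
      { s≤∣B∣       = ≤-reflexive (sym count-all)
      ; s≤∣C∣       = ≤-reflexive (sym count-all)
      ; few-U-edges = λ _ _ → ≤-reflexive (trans (count-none {n} (λ _ → false) (λ _ → refl)) (sym none-used))
      }
    4mr≡2Y : 4 * m * r ≡ 2 * Y
    4mr≡2Y = trans (*-assoc 4 m r) (*-assoc 2 2 (m * r))

-- Monochromatic triangles of G

module _ {m n r : ℕ} (G : TripartiteGraph m n) (χ : EdgeColouring m n r) where

  ColouredEdge : Fin r → Vtx m n → Vtx m n → Set
  ColouredEdge k u v = Adj G u v × col χ u v ≡ k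

  ˘_ : ∀ {k u v} → ColouredEdge k u v → ColouredEdge k v u
  ˘_ {u = u} {v} (uv , uv≡k) = Adj-sym G uv , trans (col-sym χ v u) uv≡k

  mono-triangle : ∀ {k x y z} →
    ColouredEdge k x y → ColouredEdge k y z → ColouredEdge k x z → IsMonoTriangle G χ (x , y , z)
  mono-triangle (xy , refl) (yz , yz≡k) (xz , xz≡k) = (xy , yz , xz) , sym yz≡k , sym xz≡k

  mono-triangle-edges : ∀ {x y z} → IsMonoTriangle G χ (x , y , z) →
    let k = col χ x y in ColouredEdge k x y × ColouredEdge k y z × ColouredEdge k x z
  mono-triangle-edges ((xy , yz , xz) , xy≡yz , xy≡xz) = (xy , refl) , (yz , sym xy≡yz) , (xz , sym xy≡xz)

  mono-triangle-on-edge : ∀ {u v} t → IsMonoTriangle G χ t → EdgeOf (u , v) t →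
    ∃ λ w → IsMonoTriangle G χ (u , v , w)
  mono-triangle-on-edge (x , y , z) mono uv with mono-triangle-edges mono
  ... | xy , yz , xz with uv
  ...   | inj₁ (inj₁ (refl , refl))        = z , mono
  ...   | inj₁ (inj₂ (refl , refl))        = z , mono-triangle (˘ xy) xz yz
  ...   | inj₂ (inj₁ (inj₁ (refl , refl))) = x , mono-triangle yz (˘ xz) (˘ xy)
  ...   | inj₂ (inj₁ (inj₂ (refl , refl))) = x , mono-triangle (˘ yz) (˘ xy) (˘ xz)
  ...   | inj₂ (inj₂ (inj₁ (refl , refl))) = y , mono-triangle xz (˘ yz) xy
  ...   | inj₂ (inj₂ (inj₂ (refl , refl))) = y , mono-triangle (˘ xz) xy (˘ yz)

  apex-in-V₀ : ∀ {b c} w → IsMonoTriangle G χ (v₁ b , v₂ c , w) →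
    ∃ λ a → IsMonoTriangle G χ (v₁ b , v₂ c , v₀ a)
  apex-in-V₀ (v₀ a) mono                     = a , mono
  apex-in-V₀ (v₁ _) ((_ , _ , bb′) , _)      = ⊥-elim (no-inside G bb′ refl)
  apex-in-V₀ (v₂ _) ((_ , cc′ , _) , _)      = ⊥-elim (no-inside G cc′ refl)

  module _ (full : ∀ b c → Adj G (v₁ b) (v₂ c))
           (covering : ∀ b c → ∃ λ a → IsMonoTriangle G χ (v₁ b , v₂ c , v₀ a)) where

    apex : Fin n → Fin n → Fin m
    apex b c = proj₁ (covering b c)

    colour : Fin n → Fin n → Fin r
    colour b c = col χ (v₁ b) (v₂ c)

    apex-edges : ∀ b c →
      ColouredEdge (colour b c) (v₀ (apex b c)) (v₁ b) × ColouredEdge (colour b c) (v₀ (apex b c)) (v₂ c)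
    apex-edges b c with mono-triangle-edges (proj₂ (covering b c))
    ... | _ , ca , ba = ˘ ba , ˘ ca

    row-diamond : RowDiamond apex colour → HasMonoDiamond G χ
    row-diamond (b , c , b′ , c′ , same-apex , same-colour , c≢c′ , cross) =
      v₀ (apex b c) , v₁ b , v₂ c , v₂ c′ , (λ { refl → c≢c′ refl }) ,
      mono-triangle ab (full b c , refl) ac , mono-triangle ab (full b c′ , cross) ac′
      where
      ab : ColouredEdge (colour b c) (v₀ (apex b c)) (v₁ b)
      ab = proj₁ (apex-edges b c)
      ac : ColouredEdge (colour b c) (v₀ (apex b c)) (v₂ c)
      ac = proj₂ (apex-edges b c)
      ac′ : ColouredEdge (colour b c) (v₀ (apex b c)) (v₂ c′)
      ac′ = subst₂ (λ a k → ColouredEdge k (v₀ a) (v₂ c′)) (sym same-apex) (sym same-colour)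
              (proj₂ (apex-edges b′ c′))

    column-diamond : ColumnDiamond apex colour → HasMonoDiamond G χ
    column-diamond (b , c , b′ , c′ , same-apex , same-colour , b≢b′ , cross) =
      v₀ (apex b c) , v₂ c , v₁ b , v₁ b′ , (λ { refl → b≢b′ refl }) ,
      mono-triangle ac (˘ (full b c , refl)) ab , mono-triangle ac (˘ (full b′ c , cross)) ab′
      where
      ab : ColouredEdge (colour b c) (v₀ (apex b c)) (v₁ b)
      ab = proj₁ (apex-edges b c)
      ac : ColouredEdge (colour b c) (v₀ (apex b c)) (v₂ c)
      ac = proj₂ (apex-edges b c)
      ab′ : ColouredEdge (colour b c) (v₀ (apex b c)) (v₁ b′)
      ab′ = subst₂ (λ a k → ColouredEdge k (v₀ a) (v₁ b′)) (sym same-apex) (sym same-colour)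
              (proj₁ (apex-edges b′ c′))

corollary7p2 : (r n m : ℕ) → 1 ≤ r → 1 ≤ n → 1 ≤ m →
    (4 * m * r) ^ (2 ^ (r + 3)) < n ^ (1 + 2 ^ (r + 3)) →
    (G : TripartiteGraph m n) →
    (∀ b c → Adj G (v₁ b) (v₂ c)) →
    (χ : EdgeColouring m n r) →
    (T : Fin (n * n) → Triple m n) →
    (∀ i → IsMonoTriangle G χ (T i)) →
    (∀ i j → i ≢ j → ∀ e → EdgeOf e (T i) → EdgeOf e (T j) → ⊥) →
    (∀ b c → Σ (Fin (n * n)) λ i → EdgeOf (v₁ b , v₂ c) (T i)) →
    HasMonoDiamond G χ
corollary7p2 r n m 1≤r _ 1≤m large G full χ T mono _ cover =
  [ row-diamond G χ full covering , column-diamond G χ full covering ]′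
    (apex-colouring-has-diamond (apex G χ full covering) (colour G χ full covering) large)
  where
  instance
    m≢0 : NonZero m
    m≢0 = >-nonZero 1≤m
    r≢0 : NonZero r
    r≢0 = >-nonZero 1≤r
  covering : ∀ b c → ∃ λ a → IsMonoTriangle G χ (v₁ b , v₂ c , v₀ a)
  covering b c =
    let i , bc∈Tᵢ = cover b c
        w , mono-bcw = mono-triangle-on-edge G χ (T i) (mono i) bc∈Tᵢ
    in  apex-in-V₀ G χ w mono-bcw
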